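{- A target–context functor $F\colon(\mathcal{C},T,C,\succeq)\to(\mathcal{C}',T',C',\succeq')$ maps universal simulators to universal simulators and singleton simulators to singleton simulators: if $s\colon P\otimes C\to T\otimes C$ is a universal (resp. singleton) simulator in $\mathcal{C}$, then $F(s)\colon F(P)\otimes C'\to T'\otimes C'$ is a universal (resp. singleton) simulator in $\mathcal{C}'$.
   Context: A gs-monoidal category is a symmetric monoidal category (tensor $\otimes$, unit $I$) whose objects carry commutative comonoids $\mathrm{copy}_A\colon A\to A\otimes A$, $\mathrm{del}_A\colon A\to I$ compatible with $\otimes$, with $\mathrm{del}_I=\mathrm{id}_I$. For $f\colon A\to X$: $\mathrm{dom}(f)=(\mathrm{id}_A\otimes(\mathrm{del}_X\circ f))\circ\mathrm{copy}_A$; normalized: $f\circ\mathrm{dom}(f)=f$; functional: $\mathrm{copy}_X\circ f=(f\otimes f)\circ\mathrm{copy}_A$. A target–context category $(\mathcal{C},T,C,\succeq)$ is a gs-monoidal category with all morphisms normalized, objects $T,C$ and a preorder $\succeq$ on each $\mathcal{C}(A,T\otimes C)$ with $f\circ\mathrm{dom}(g)=g\Rightarrow f\succeq g$ and $f\succeq g\Rightarrow f\circ h\succeq g\circ h$. A simulator with programs $P$: $s\colon P\otimes C\to T\otimes C$ such that there are a functional $s_T\colon P\to T$ (compiler) and $s_C\colon P\otimes C\to C$ with $s=(s_T\otimes s_C)\circ(\mathrm{copy}_P\otimes\mathrm{id}_C)$, $(\mathrm{id}_T\otimes\mathrm{del}_C)\circ s=s_T\otimes\mathrm{del}_C$, $(\mathrm{del}_T\otimes\mathrm{id}_C)\circ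 s=s_C$. It is universal if there is a functional $r\colon T\to P$ with $s\circ(r\otimes\mathrm{id}_C)\succeq\mathrm{id}_{T\otimes C}$, and singleton if $s_T=t\circ\mathrm{del}_P$ for a functional state $t\colon I\to T$. A target–context functor is a strong gs-monoidal functor $F\colon\mathcal{C}\to\mathcal{C}'$ (strong symmetric monoidal, sending $\mathrm{copy}_A,\mathrm{del}_A$ to $\mathrm{copy}_{FA},\mathrm{del}_{FA}$ up to coherence isomorphisms) with $F(T)=T'$, $F(C)=C'$ and $f\succeq g\Rightarrow F(f)\succeq'F(g)$ for all $f,g\colon A\to T\otimes C$. -}

module Defs where

open import Level using (Level; _⊔_) renaming (suc to lsuc)
open import Relation.Binary.PropositionalEquality using (_≡_; refl; sym)
open import Data.Product using (Σ; _×_; _,_; ∃; ∃-syntax)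

record SymmetricMonoidalCategory (o ℓ : Level) : Set (lsuc (o ⊔ ℓ)) where
  infixr 9 _∘_
  infixr 10 _⊗₀_ _⊗₁_
  field
    Obj : Set o
    _⇒_ : Obj → Obj → Set ℓ
    id  : ∀ {A} → A ⇒ A
    _∘_ : ∀ {A B C} → B ⇒ C → A ⇒ B → A ⇒ C
    identityˡ : ∀ {A B} {f : A ⇒ B} → id ∘ f ≡ f
    identityʳ : ∀ {A B} {f : A ⇒ B} → f ∘ id ≡ f
    assoc : ∀ {A B C D} {f : A ⇒ B} {g : B ⇒ C} {h : C ⇒ D} →
            (h ∘ g) ∘ f ≡ h ∘ (g ∘ f)
    _⊗₀_ : Obj → Obj → Obj
    _⊗₁_ : ∀ {A B C D} → A ⇒ B → C ⇒ D → (A ⊗₀ C) ⇒ (B ⊗₀ D)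
    I : Obj
    ⊗-id : ∀ {A B} → id {A} ⊗₁ id {B} ≡ id
    ⊗-∘  : ∀ {A B C D E G} {f : A ⇒ B} {g : B ⇒ C} {h : D ⇒ E} {k : E ⇒ G} →
           (g ∘ f) ⊗₁ (k ∘ h) ≡ (g ⊗₁ k) ∘ (f ⊗₁ h)
    α⇒ : ∀ {A B C} → ((A ⊗₀ B) ⊗₀ C) ⇒ (A ⊗₀ (B ⊗₀ C))
    α⇐ : ∀ {A B C} → (A ⊗₀ (B ⊗₀ C)) ⇒ ((A ⊗₀ B) ⊗₀ C)
    α-isoˡ : ∀ {A B C} → α⇐ ∘ α⇒ {A} {B} {C} ≡ id
    α-isoʳ : ∀ {A B C} → α⇒ ∘ α⇐ {A} {B} {C} ≡ id
    α-natural : ∀ {A B C D E G} {f : A ⇒ D} {g : B ⇒ E} {h : C ⇒ G} →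
                α⇒ ∘ ((f ⊗₁ g) ⊗₁ h) ≡ (f ⊗₁ (g ⊗₁ h)) ∘ α⇒
    λ⇒ : ∀ {A} → (I ⊗₀ A) ⇒ A
    λ⇐ : ∀ {A} → A ⇒ (I ⊗₀ A)
    λ-isoˡ : ∀ {A} → λ⇐ ∘ λ⇒ {A} ≡ id
    λ-isoʳ : ∀ {A} → λ⇒ ∘ λ⇐ {A} ≡ id
    λ-natural : ∀ {A B} {f : A ⇒ B} → λ⇒ ∘ (id ⊗₁ f) ≡ f ∘ λ⇒
    ρ⇒ : ∀ {A} → (A ⊗₀ I) ⇒ A
    ρ⇐ : ∀ {A} → A ⇒ (A ⊗₀ I)
    ρ-isoˡ : ∀ {A} → ρ⇐ ∘ ρ⇒ {A} ≡ id
    ρ-isoʳ : ∀ {A} → ρ⇒ ∘ ρ⇐ {A} ≡ id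
    ρ-natural : ∀ {A B} {f : A ⇒ B} → ρ⇒ ∘ (f ⊗₁ id) ≡ f ∘ ρ⇒
    pentagon : ∀ {A B C D} →
      (id {A} ⊗₁ α⇒ {B} {C} {D}) ∘ α⇒ ∘ (α⇒ ⊗₁ id) ≡ α⇒ ∘ α⇒
    triangle : ∀ {A B} → (id {A} ⊗₁ λ⇒ {B}) ∘ α⇒ ≡ ρ⇒ ⊗₁ id
    σ : ∀ {A B} → (A ⊗₀ B) ⇒ (B ⊗₀ A)
    σ-natural : ∀ {A B C D} {f : A ⇒ B} {g : C ⇒ D} →
                σ ∘ (f ⊗₁ g) ≡ (g ⊗₁ f) ∘ σ
    σ-involutive : ∀ {A B} → σ {B} {A} ∘ σ {A} {B} ≡ id
    hexagon : ∀ {A B C} →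
      (id {B} ⊗₁ σ {A} {C}) ∘ α⇒ ∘ (σ ⊗₁ id) ≡ α⇒ ∘ σ ∘ α⇒

  interchange : ∀ {A A' B B'} → ((A ⊗₀ A') ⊗₀ (B ⊗₀ B')) ⇒ ((A ⊗₀ B) ⊗₀ (A' ⊗₀ B'))
  interchange = α⇐ ∘ (id ⊗₁ (α⇒ ∘ (σ ⊗₁ id) ∘ α⇐)) ∘ α⇒

  ≡⇒ : ∀ {A B} → A ≡ B → A ⇒ B
  ≡⇒ refl = id

record GSMonoidalCategory (o ℓ : Level) : Set (lsuc (o ⊔ ℓ)) where
  field
    smc : SymmetricMonoidalCategory o ℓ
  open SymmetricMonoidalCategory smc public
  field
    copy : ∀ {A} → A ⇒ (A ⊗₀ A)
    del  : ∀ {A} → A ⇒ I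
    copy-counitˡ : ∀ {A} → λ⇒ ∘ (del ⊗₁ id) ∘ copy {A} ≡ id
    copy-counitʳ : ∀ {A} → ρ⇒ ∘ (id ⊗₁ del) ∘ copy {A} ≡ id
    copy-assoc   : ∀ {A} → α⇒ ∘ (copy ⊗₁ id) ∘ copy {A} ≡ (id ⊗₁ copy) ∘ copy
    copy-comm    : ∀ {A} → σ ∘ copy {A} ≡ copy
    copy-⊗ : ∀ {A B} → copy {A ⊗₀ B} ≡ interchange ∘ (copy ⊗₁ copy)
    del-⊗  : ∀ {A B} → del {A ⊗₀ B} ≡ λ⇒ ∘ (del ⊗₁ del)
    del-I  : del {I} ≡ id

  -- dom(f) = (id_A ⊗ (del_X ∘ f)) ∘ copy_A, composed with ρ : A ⊗ I ≅ A
  dom : ∀ {A X} → A ⇒ X → A ⇒ A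
  dom f = ρ⇒ ∘ (id ⊗₁ (del ∘ f)) ∘ copy

  Normalized : ∀ {A X} → A ⇒ X → Set ℓ
  Normalized f = f ∘ dom f ≡ f

  Functional : ∀ {A X} → A ⇒ X → Set ℓ
  Functional f = copy ∘ f ≡ (f ⊗₁ f) ∘ copy

record TargetContextCategory (o ℓ e : Level) : Set (lsuc (o ⊔ ℓ ⊔ e)) where
  field
    gs : GSMonoidalCategory o ℓ
  open GSMonoidalCategory gs public
  field
    normalized : ∀ {A X} (f : A ⇒ X) → Normalized f
    T C : Obj
    _≽_ : ∀ {A} → A ⇒ (T ⊗₀ C) → A ⇒ (T ⊗₀ C) → Set e
    ≽-refl  : ∀ {A} {f : A ⇒ (T ⊗₀ C)} → f ≽ f
    ≽-trans : ∀ {A} {f g h : A ⇒ (T ⊗₀ C)} → f ≽ g → g ≽ h → f ≽ h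
    ≽-dom   : ∀ {A} {f g : A ⇒ (T ⊗₀ C)} → f ∘ dom g ≡ g → f ≽ g
    ≽-∘     : ∀ {A B} {f g : B ⇒ (T ⊗₀ C)} {h : A ⇒ B} → f ≽ g → (f ∘ h) ≽ (g ∘ h)

  record SimulatorData {P : Obj} (s : (P ⊗₀ C) ⇒ (T ⊗₀ C)) : Set (o ⊔ ℓ) where
    field
      sT : P ⇒ T
      sC : (P ⊗₀ C) ⇒ C
      sT-functional : Functional sT
      s-decomp : s ≡ (sT ⊗₁ sC) ∘ α⇒ ∘ (copy ⊗₁ id)
      s-delC   : (id ⊗₁ del) ∘ s ≡ sT ⊗₁ del
      s-delT   : λ⇒ ∘ (del ⊗₁ id) ∘ s ≡ sC

  IsSimulator : ∀ {P} → (P ⊗₀ C) ⇒ (T ⊗₀ C) → Set (o ⊔ ℓ)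
  IsSimulator s = SimulatorData s

  IsUniversalSimulator : ∀ {P} → (P ⊗₀ C) ⇒ (T ⊗₀ C) → Set (o ⊔ ℓ ⊔ e)
  IsUniversalSimulator {P} s =
    IsSimulator s ×
    Σ (T ⇒ P) (λ r → Functional r × ((s ∘ (r ⊗₁ id)) ≽ id))

  IsSingletonSimulator : ∀ {P} → (P ⊗₀ C) ⇒ (T ⊗₀ C) → Set (o ⊔ ℓ)
  IsSingletonSimulator {P} s =
    Σ (SimulatorData s) (λ d →
      Σ (I ⇒ T) (λ t → Functional t × SimulatorData.sT d ≡ t ∘ del))

record TargetContextFunctor {o ℓ e o' ℓ' e'}
    (𝒜 : TargetContextCategory o ℓ e) (ℬ : TargetContextCategory o' ℓ' e')
    : Set (o ⊔ ℓ ⊔ e ⊔ o' ⊔ ℓ' ⊔ e') where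
  private
    module A = TargetContextCategory 𝒜
    module B = TargetContextCategory ℬ
  field
    F₀ : A.Obj → B.Obj
    F₁ : ∀ {X Y} → X A.⇒ Y → F₀ X B.⇒ F₀ Y
    F-id : ∀ {X} → F₁ (A.id {X}) ≡ B.id
    F-∘  : ∀ {X Y Z} {f : X A.⇒ Y} {g : Y A.⇒ Z} → F₁ (g A.∘ f) ≡ F₁ g B.∘ F₁ f
    φ⇒ : ∀ {X Y} → (F₀ X B.⊗₀ F₀ Y) B.⇒ F₀ (X A.⊗₀ Y)
    φ⇐ : ∀ {X Y} → F₀ (X A.⊗₀ Y) B.⇒ (F₀ X B.⊗₀ F₀ Y)
    φ-isoˡ : ∀ {X Y} → φ⇐ B.∘ φ⇒ {X} {Y} ≡ B.id
    φ-isoʳ : ∀ {X Y} → φ⇒ B.∘ φ⇐ {X} {Y} ≡ B.id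
    φ-natural : ∀ {X X' Y Y'} {f : X A.⇒ X'} {g : Y A.⇒ Y'} →
                F₁ (f A.⊗₁ g) B.∘ φ⇒ ≡ φ⇒ B.∘ (F₁ f B.⊗₁ F₁ g)
    ε⇒ : B.I B.⇒ F₀ A.I
    ε⇐ : F₀ A.I B.⇒ B.I
    ε-isoˡ : ε⇐ B.∘ ε⇒ ≡ B.id
    ε-isoʳ : ε⇒ B.∘ ε⇐ ≡ B.id
    φ-assoc : ∀ {X Y Z} →
      F₁ (A.α⇒ {X} {Y} {Z}) B.∘ φ⇒ B.∘ (φ⇒ B.⊗₁ B.id)
        ≡ φ⇒ B.∘ (B.id B.⊗₁ φ⇒) B.∘ B.α⇒
    φ-unitˡ : ∀ {X} → F₁ (A.λ⇒ {X}) B.∘ φ⇒ B.∘ (ε⇒ B.⊗₁ B.id) ≡ B.λ⇒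
    φ-unitʳ : ∀ {X} → F₁ (A.ρ⇒ {X}) B.∘ φ⇒ B.∘ (B.id B.⊗₁ ε⇒) ≡ B.ρ⇒
    φ-σ : ∀ {X Y} → F₁ (A.σ {X} {Y}) B.∘ φ⇒ ≡ φ⇒ B.∘ B.σ
    F-copy : ∀ {X} → F₁ (A.copy {X}) ≡ φ⇒ B.∘ B.copy
    F-del  : ∀ {X} → F₁ (A.del {X}) ≡ ε⇒ B.∘ B.del
    F-T : F₀ A.T ≡ B.T
    F-C : F₀ A.C ≡ B.C

  F↓ : ∀ {X} → X A.⇒ (A.T A.⊗₀ A.C) → F₀ X B.⇒ (B.T B.⊗₀ B.C)
  F↓ f = (B.≡⇒ F-T B.⊗₁ B.≡⇒ F-C) B.∘ φ⇐ B.∘ F₁ f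

  field
    F-≽ : ∀ {X} {f g : X A.⇒ (A.T A.⊗₀ A.C)} → f A.≽ g → F↓ f B.≽ F↓ g

  F-sim : ∀ {P} → (P A.⊗₀ A.C) A.⇒ (A.T A.⊗₀ A.C) →
          (F₀ P B.⊗₀ B.C) B.⇒ (B.T B.⊗₀ B.C)
  F-sim s = F↓ s B.∘ φ⇒ B.∘ (B.id B.⊗₁ B.≡⇒ (sym F-C))

{-# OPTIONS --safe #-}
-- Read on tensors, F⊗ f = φ⇐ ∘ F f ∘ φ⇒ is functorial, sends f ⊗ g to F f ⊗ F g and
-- preserves copying and (up to the iso ε) deletion.  Hence a simulator (s_T , s_C) over T, C
-- becomes the simulator (F s_T , F s_C ∘ φ⇒) over F T, F C, and transporting along F T = T'
-- and F C = C' turns it into F(s).  A witness r of universality goes to F r because F is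
-- monotone for ≽ and F(s ∘ (r ⊗ id)) is F(s) ∘ (F r ⊗ id) up to that transport; a singleton
-- compiler t ∘ del goes to (F t ∘ ε) ∘ del, where ε is functional as copy_I = λ⇐.
module Submission where

open import Data.Product using (_×_; _,_)
open import Relation.Binary.PropositionalEquality
  using (_≡_; refl; sym; trans; cong; cong₂; subst₂; module ≡-Reasoning)

open import Defs

module MonoidalReasoning {o ℓ} (𝒞 : SymmetricMonoidalCategory o ℓ) where
  open SymmetricMonoidalCategory 𝒞
  open ≡-Reasoning

  pullˡ : ∀ {A B C D} {f : C ⇒ D} {g : B ⇒ C} {h : B ⇒ D} {k : A ⇒ B} →
          f ∘ g ≡ h → f ∘ g ∘ k ≡ h ∘ k
  pullˡ {k = k} eq = trans (sym assoc) (cong (_∘ k) eq)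

  cancelˡ : ∀ {A B C} {f : B ⇒ C} {g : C ⇒ B} {h : A ⇒ C} →
            f ∘ g ≡ id → f ∘ g ∘ h ≡ h
  cancelˡ eq = trans (pullˡ eq) identityˡ

  ⊗-∘-⊗ : ∀ {A B C D E G} {f : B ⇒ C} {g : E ⇒ G} {h : A ⇒ B} {k : D ⇒ E} →
          (f ⊗₁ g) ∘ (h ⊗₁ k) ≡ (f ∘ h) ⊗₁ (g ∘ k)
  ⊗-∘-⊗ = sym ⊗-∘

  ∘-⊗-id : ∀ {A B C D} {f : B ⇒ C} {g : A ⇒ B} →
           (f ∘ g) ⊗₁ id {D} ≡ (f ⊗₁ id) ∘ (g ⊗₁ id)
  ∘-⊗-id = trans (cong (_ ⊗₁_) (sym identityˡ)) ⊗-∘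

  λ⇐-natural : ∀ {A B} {f : A ⇒ B} → λ⇐ ∘ f ≡ (id ⊗₁ f) ∘ λ⇐
  λ⇐-natural {f = f} = begin
    λ⇐ ∘ f
      ≡⟨ cong (λ⇐ ∘_) (sym identityʳ) ⟩
    λ⇐ ∘ f ∘ id
      ≡⟨ cong (λ u → λ⇐ ∘ f ∘ u) (sym λ-isoʳ) ⟩
    λ⇐ ∘ f ∘ λ⇒ ∘ λ⇐
      ≡⟨ cong (λ⇐ ∘_) (pullˡ (sym λ-natural)) ⟩
    λ⇐ ∘ (λ⇒ ∘ (id ⊗₁ f)) ∘ λ⇐
      ≡⟨ cong (λ⇐ ∘_) assoc ⟩
    λ⇐ ∘ λ⇒ ∘ (id ⊗₁ f) ∘ λ⇐
      ≡⟨ cancelˡ λ-isoˡ ⟩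
    (id ⊗₁ f) ∘ λ⇐ ∎

  relabel : ∀ {P₀ T₀ C₀ P T C} → P₀ ≡ P → T₀ ≡ T → C₀ ≡ C →
            (P₀ ⊗₀ C₀) ⇒ (T₀ ⊗₀ C₀) → (P ⊗₀ C) ⇒ (T ⊗₀ C)
  relabel eP eT eC g = (≡⇒ eT ⊗₁ ≡⇒ eC) ∘ g ∘ ≡⇒ (sym eP) ⊗₁ ≡⇒ (sym eC)

  relabel-refl : ∀ {P T C} (g : (P ⊗₀ C) ⇒ (T ⊗₀ C)) → relabel refl refl refl g ≡ g
  relabel-refl g = begin
    (id ⊗₁ id) ∘ g ∘ id ⊗₁ id
      ≡⟨ cong₂ (λ u v → u ∘ g ∘ v) ⊗-id ⊗-id ⟩
    id ∘ g ∘ id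
      ≡⟨ identityˡ ⟩
    g ∘ id
      ≡⟨ identityʳ ⟩
    g ∎

  relabel-id : ∀ {T₀ C₀ T C} (eT : T₀ ≡ T) (eC : C₀ ≡ C) → relabel eT eT eC id ≡ id
  relabel-id refl refl = relabel-refl id

  relabel-∘-⊗id : ∀ {Q₀ P T₀ C₀ Q T C} (eQ : Q₀ ≡ Q) (eT : T₀ ≡ T) (eC : C₀ ≡ C)
                  (g : (P ⊗₀ C₀) ⇒ (T₀ ⊗₀ C₀)) (u : Q₀ ⇒ P) →
                  relabel eQ eT eC (g ∘ u ⊗₁ id)
                    ≡ relabel refl eT eC g ∘ (u ∘ ≡⇒ (sym eQ)) ⊗₁ id
  relabel-∘-⊗id refl refl refl g u = begin
    relabel refl refl refl (g ∘ u ⊗₁ id)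
      ≡⟨ relabel-refl (g ∘ u ⊗₁ id) ⟩
    g ∘ u ⊗₁ id
      ≡⟨ cong₂ (λ a b → a ∘ b ⊗₁ id) (sym (relabel-refl g)) (sym identityʳ) ⟩
    relabel refl refl refl g ∘ (u ∘ id) ⊗₁ id ∎

module GSProperties {o ℓ} (𝒢 : GSMonoidalCategory o ℓ) where
  open GSMonoidalCategory 𝒢
  open MonoidalReasoning smc
  open ≡-Reasoning

  duplicateˡ : ∀ {A B} → (A ⊗₀ B) ⇒ (A ⊗₀ (A ⊗₀ B))
  duplicateˡ = α⇒ ∘ copy ⊗₁ id

  π₂ : ∀ {A B} → (A ⊗₀ B) ⇒ B
  π₂ = λ⇒ ∘ del ⊗₁ id

  Functional-∘ : ∀ {A B C} {g : B ⇒ C} {f : A ⇒ B} →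
                 Functional g → Functional f → Functional (g ∘ f)
  Functional-∘ {g = g} {f} g-fun f-fun = begin
    copy ∘ g ∘ f
      ≡⟨ pullˡ g-fun ⟩
    ((g ⊗₁ g) ∘ copy) ∘ f
      ≡⟨ assoc ⟩
    (g ⊗₁ g) ∘ copy ∘ f
      ≡⟨ cong ((g ⊗₁ g) ∘_) f-fun ⟩
    (g ⊗₁ g) ∘ (f ⊗₁ f) ∘ copy
      ≡⟨ pullˡ ⊗-∘-⊗ ⟩
    (g ∘ f) ⊗₁ (g ∘ f) ∘ copy ∎

  ≡⇒-Functional : ∀ {A B} (e : A ≡ B) → Functional (≡⇒ e)
  ≡⇒-Functional refl = begin
    copy ∘ id
      ≡⟨ identityʳ ⟩
    copy
      ≡⟨ sym identityˡ ⟩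
    id ∘ copy
      ≡⟨ cong (_∘ copy) (sym ⊗-id) ⟩
    (id ⊗₁ id) ∘ copy ∎

  copy-I : copy {I} ≡ λ⇐
  copy-I = begin
    copy
      ≡⟨ sym (cancelˡ λ-isoˡ) ⟩
    λ⇐ ∘ λ⇒ ∘ copy
      ≡⟨ cong (λ u → λ⇐ ∘ λ⇒ ∘ u) (sym identityˡ) ⟩
    λ⇐ ∘ λ⇒ ∘ id ∘ copy
      ≡⟨ cong (λ u → λ⇐ ∘ λ⇒ ∘ u ∘ copy) (sym ⊗-id) ⟩
    λ⇐ ∘ λ⇒ ∘ (id ⊗₁ id) ∘ copy
      ≡⟨ cong (λ u → λ⇐ ∘ λ⇒ ∘ u ⊗₁ id ∘ copy) (sym del-I) ⟩
    λ⇐ ∘ λ⇒ ∘ (del ⊗₁ id) ∘ copy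
      ≡⟨ cong (λ⇐ ∘_) copy-counitˡ ⟩
    λ⇐ ∘ id
      ≡⟨ identityʳ ⟩
    λ⇐ ∎

  -- SimulatorData for an arbitrary target T and context C; F produces simulators over F₀ T and F₀ C.
  record Simulator {P T C} (s : (P ⊗₀ C) ⇒ (T ⊗₀ C)) : Set ℓ where
    field
      sT : P ⇒ T
      sC : (P ⊗₀ C) ⇒ C
      sT-functional : Functional sT
      s-decomp : s ≡ (sT ⊗₁ sC) ∘ duplicateˡ
      s-delC   : (id ⊗₁ del) ∘ s ≡ sT ⊗₁ del
      s-delT   : λ⇒ ∘ (del ⊗₁ id) ∘ s ≡ sC

module TargetContextProperties {o ℓ e} (𝒞 : TargetContextCategory o ℓ e) where
  open TargetContextCategory 𝒞
  open MonoidalReasoning smc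
  open GSProperties gs using (Simulator)

  relabel-SimulatorData : ∀ {P T₀ C₀} (eT : T₀ ≡ T) (eC : C₀ ≡ C)
                          {g : (P ⊗₀ C₀) ⇒ (T₀ ⊗₀ C₀)} {s : (P ⊗₀ C) ⇒ (T ⊗₀ C)} →
                          s ≡ relabel refl eT eC g → Simulator g → SimulatorData s
  relabel-SimulatorData refl refl {g} {s} s≡ d = record
    { sT = sT
    ; sC = sC
    ; sT-functional = sT-functional
    ; s-decomp = trans s≡g s-decomp
    ; s-delC = trans (cong ((id ⊗₁ del) ∘_) s≡g) s-delC
    ; s-delT = trans (cong (λ u → λ⇒ ∘ del ⊗₁ id ∘ u) s≡g) s-delT
    }
    where
    open Simulator d
    s≡g : s ≡ g
    s≡g = trans s≡ (relabel-refl g)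

  relabel-sT : ∀ {P T₀ C₀} (eT : T₀ ≡ T) (eC : C₀ ≡ C)
               {g : (P ⊗₀ C₀) ⇒ (T₀ ⊗₀ C₀)} {s : (P ⊗₀ C) ⇒ (T ⊗₀ C)}
               (s≡ : s ≡ relabel refl eT eC g) (d : Simulator g) →
               SimulatorData.sT (relabel-SimulatorData eT eC s≡ d) ≡ ≡⇒ eT ∘ Simulator.sT d
  relabel-sT refl refl s≡ d = sym identityˡ

module TargetContextFunctorProperties {o ℓ e o' ℓ' e'}
    {𝒜 : TargetContextCategory o ℓ e} {ℬ : TargetContextCategory o' ℓ' e'}
    (F : TargetContextFunctor 𝒜 ℬ) where
  private
    module A where
      open TargetContextCategory 𝒜 public
      open GSProperties gs public
  open TargetContextCategory ℬ
  open TargetContextFunctor F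
  open MonoidalReasoning smc
  open GSProperties gs
  open TargetContextProperties ℬ
  open ≡-Reasoning

  F⊗ : ∀ {X Y Z W} → (X A.⊗₀ Y) A.⇒ (Z A.⊗₀ W) → (F₀ X ⊗₀ F₀ Y) ⇒ (F₀ Z ⊗₀ F₀ W)
  F⊗ f = φ⇐ ∘ F₁ f ∘ φ⇒

  F⊗-id : ∀ {X Y} → F⊗ (A.id {X A.⊗₀ Y}) ≡ id
  F⊗-id = begin
    φ⇐ ∘ F₁ A.id ∘ φ⇒
      ≡⟨ cong (λ u → φ⇐ ∘ u ∘ φ⇒) F-id ⟩
    φ⇐ ∘ id ∘ φ⇒
      ≡⟨ cong (φ⇐ ∘_) identityˡ ⟩
    φ⇐ ∘ φ⇒
      ≡⟨ φ-isoˡ ⟩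
    id ∎

  F⊗-∘ : ∀ {X Y Z W U V}
         {f : (X A.⊗₀ Y) A.⇒ (Z A.⊗₀ W)} {g : (Z A.⊗₀ W) A.⇒ (U A.⊗₀ V)} →
         F⊗ (g A.∘ f) ≡ F⊗ g ∘ F⊗ f
  F⊗-∘ {f = f} {g} = begin
    φ⇐ ∘ F₁ (g A.∘ f) ∘ φ⇒
      ≡⟨ cong (λ u → φ⇐ ∘ u ∘ φ⇒) F-∘ ⟩
    φ⇐ ∘ (F₁ g ∘ F₁ f) ∘ φ⇒
      ≡⟨ cong (φ⇐ ∘_) assoc ⟩
    φ⇐ ∘ F₁ g ∘ F₁ f ∘ φ⇒
      ≡⟨ cong (λ u → φ⇐ ∘ F₁ g ∘ u) (sym (cancelˡ φ-isoʳ)) ⟩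
    φ⇐ ∘ F₁ g ∘ φ⇒ ∘ φ⇐ ∘ F₁ f ∘ φ⇒
      ≡⟨ cong (φ⇐ ∘_) (sym assoc) ⟩
    φ⇐ ∘ (F₁ g ∘ φ⇒) ∘ F⊗ f
      ≡⟨ sym assoc ⟩
    F⊗ g ∘ F⊗ f ∎

  F⊗-⊗ : ∀ {X Y Z W} {f : X A.⇒ Z} {g : Y A.⇒ W} → F⊗ (f A.⊗₁ g) ≡ F₁ f ⊗₁ F₁ g
  F⊗-⊗ = trans (cong (φ⇐ ∘_) φ-natural) (cancelˡ φ-isoˡ)

  F⊗-∘-⊗id : ∀ {X Y Z W V} {f : (X A.⊗₀ Y) A.⇒ (Z A.⊗₀ W)} {g : V A.⇒ X} →
             F⊗ (f A.∘ g A.⊗₁ A.id) ≡ F⊗ f ∘ F₁ g ⊗₁ id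
  F⊗-∘-⊗id {f = f} {g} = trans F⊗-∘ (cong (F⊗ f ∘_) (trans F⊗-⊗ (cong (F₁ g ⊗₁_) F-id)))

  F⊗-duplicateˡ : ∀ {X Y} → F⊗ (A.duplicateˡ {X} {Y}) ≡ (id ⊗₁ φ⇒) ∘ duplicateˡ
  F⊗-duplicateˡ = begin
    φ⇐ ∘ F₁ (A.α⇒ A.∘ A.copy A.⊗₁ A.id) ∘ φ⇒
      ≡⟨ cong (λ u → φ⇐ ∘ u ∘ φ⇒) F-∘ ⟩
    φ⇐ ∘ (F₁ A.α⇒ ∘ F₁ (A.copy A.⊗₁ A.id)) ∘ φ⇒
      ≡⟨ cong (φ⇐ ∘_) (trans assoc (cong (F₁ A.α⇒ ∘_) φ-natural)) ⟩
    φ⇐ ∘ F₁ A.α⇒ ∘ φ⇒ ∘ F₁ A.copy ⊗₁ F₁ A.id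
      ≡⟨ cong (λ u → φ⇐ ∘ F₁ A.α⇒ ∘ φ⇒ ∘ u) (cong₂ _⊗₁_ F-copy F-id) ⟩
    φ⇐ ∘ F₁ A.α⇒ ∘ φ⇒ ∘ (φ⇒ ∘ copy) ⊗₁ id
      ≡⟨ cong (λ u → φ⇐ ∘ F₁ A.α⇒ ∘ φ⇒ ∘ u) ∘-⊗-id ⟩
    φ⇐ ∘ F₁ A.α⇒ ∘ φ⇒ ∘ (φ⇒ ⊗₁ id) ∘ copy ⊗₁ id
      ≡⟨ cong (φ⇐ ∘_) (trans (cong (F₁ A.α⇒ ∘_) (sym assoc)) (pullˡ φ-assoc)) ⟩
    φ⇐ ∘ (φ⇒ ∘ (id ⊗₁ φ⇒) ∘ α⇒) ∘ copy ⊗₁ id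
      ≡⟨ cong (φ⇐ ∘_) (trans assoc (cong (φ⇒ ∘_) assoc)) ⟩
    φ⇐ ∘ φ⇒ ∘ (id ⊗₁ φ⇒) ∘ duplicateˡ
      ≡⟨ cancelˡ φ-isoˡ ⟩
    (id ⊗₁ φ⇒) ∘ duplicateˡ ∎

  copy-F₀ : ∀ {X} → copy {F₀ X} ≡ φ⇐ ∘ F₁ A.copy
  copy-F₀ = trans (sym (cancelˡ φ-isoˡ)) (cong (φ⇐ ∘_) (sym F-copy))

  F-Functional : ∀ {X Y} {f : X A.⇒ Y} → A.Functional f → Functional (F₁ f)
  F-Functional {f = f} f-fun = begin
    copy ∘ F₁ f
      ≡⟨ cong (_∘ F₁ f) copy-F₀ ⟩
    (φ⇐ ∘ F₁ A.copy) ∘ F₁ f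
      ≡⟨ trans assoc (cong (φ⇐ ∘_) (sym F-∘)) ⟩
    φ⇐ ∘ F₁ (A.copy A.∘ f)
      ≡⟨ cong (λ u → φ⇐ ∘ F₁ u) f-fun ⟩
    φ⇐ ∘ F₁ ((f A.⊗₁ f) A.∘ A.copy)
      ≡⟨ cong (φ⇐ ∘_) (trans F-∘ (cong (F₁ (f A.⊗₁ f) ∘_) F-copy)) ⟩
    φ⇐ ∘ F₁ (f A.⊗₁ f) ∘ φ⇒ ∘ copy
      ≡⟨ trans (cong (φ⇐ ∘_) (sym assoc)) (sym assoc) ⟩
    F⊗ (f A.⊗₁ f) ∘ copy
      ≡⟨ cong (_∘ copy) F⊗-⊗ ⟩
    (F₁ f ⊗₁ F₁ f) ∘ copy ∎

  F-λ⇐ : ∀ {X} → F₁ (A.λ⇐ {X}) ≡ φ⇒ ∘ (ε⇒ ⊗₁ id) ∘ λ⇐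
  F-λ⇐ = begin
    F₁ A.λ⇐
      ≡⟨ sym identityʳ ⟩
    F₁ A.λ⇐ ∘ id
      ≡⟨ cong (F₁ A.λ⇐ ∘_) (sym λ-isoʳ) ⟩
    F₁ A.λ⇐ ∘ λ⇒ ∘ λ⇐
      ≡⟨ cong (λ u → F₁ A.λ⇐ ∘ u ∘ λ⇐) (sym φ-unitˡ) ⟩
    F₁ A.λ⇐ ∘ (F₁ A.λ⇒ ∘ φ⇒ ∘ (ε⇒ ⊗₁ id)) ∘ λ⇐
      ≡⟨ cong (F₁ A.λ⇐ ∘_) assoc ⟩
    F₁ A.λ⇐ ∘ F₁ A.λ⇒ ∘ (φ⇒ ∘ (ε⇒ ⊗₁ id)) ∘ λ⇐
      ≡⟨ pullˡ (trans (sym F-∘) (trans (cong F₁ A.λ-isoˡ) F-id)) ⟩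
    id ∘ (φ⇒ ∘ (ε⇒ ⊗₁ id)) ∘ λ⇐
      ≡⟨ trans identityˡ assoc ⟩
    φ⇒ ∘ (ε⇒ ⊗₁ id) ∘ λ⇐ ∎

  ε⇒-Functional : Functional ε⇒
  ε⇒-Functional = begin
    copy ∘ ε⇒
      ≡⟨ cong (_∘ ε⇒) (trans copy-F₀ (cong (λ u → φ⇐ ∘ F₁ u) A.copy-I)) ⟩
    (φ⇐ ∘ F₁ A.λ⇐) ∘ ε⇒
      ≡⟨ cong (λ u → (φ⇐ ∘ u) ∘ ε⇒) F-λ⇐ ⟩
    (φ⇐ ∘ φ⇒ ∘ (ε⇒ ⊗₁ id) ∘ λ⇐) ∘ ε⇒
      ≡⟨ cong (_∘ ε⇒) (cancelˡ φ-isoˡ) ⟩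
    ((ε⇒ ⊗₁ id) ∘ λ⇐) ∘ ε⇒
      ≡⟨ trans assoc (cong ((ε⇒ ⊗₁ id) ∘_) λ⇐-natural) ⟩
    (ε⇒ ⊗₁ id) ∘ (id ⊗₁ ε⇒) ∘ λ⇐
      ≡⟨ pullˡ (trans ⊗-∘-⊗ (cong₂ _⊗₁_ identityʳ identityˡ)) ⟩
    (ε⇒ ⊗₁ ε⇒) ∘ λ⇐
      ≡⟨ cong ((ε⇒ ⊗₁ ε⇒) ∘_) (sym copy-I) ⟩
    (ε⇒ ⊗₁ ε⇒) ∘ copy ∎

  F-π₂ : ∀ {X Y} → F₁ (A.π₂ {X} {Y}) ∘ φ⇒ ≡ π₂
  F-π₂ = begin
    F₁ (A.λ⇒ A.∘ A.del A.⊗₁ A.id) ∘ φ⇒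
      ≡⟨ trans (cong (_∘ φ⇒) F-∘) assoc ⟩
    F₁ A.λ⇒ ∘ F₁ (A.del A.⊗₁ A.id) ∘ φ⇒
      ≡⟨ cong (F₁ A.λ⇒ ∘_) φ-natural ⟩
    F₁ A.λ⇒ ∘ φ⇒ ∘ F₁ A.del ⊗₁ F₁ A.id
      ≡⟨ cong (λ u → F₁ A.λ⇒ ∘ φ⇒ ∘ u) (trans (cong₂ _⊗₁_ F-del F-id) ∘-⊗-id) ⟩
    F₁ A.λ⇒ ∘ φ⇒ ∘ (ε⇒ ⊗₁ id) ∘ del ⊗₁ id
      ≡⟨ cong (F₁ A.λ⇒ ∘_) (sym assoc) ⟩
    F₁ A.λ⇒ ∘ (φ⇒ ∘ (ε⇒ ⊗₁ id)) ∘ del ⊗₁ id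
      ≡⟨ pullˡ φ-unitˡ ⟩
    λ⇒ ∘ del ⊗₁ id ∎

  ε⇐-F-del : ∀ {X} → ε⇐ ∘ F₁ (A.del {X}) ≡ del
  ε⇐-F-del = trans (cong (ε⇐ ∘_) F-del) (cancelˡ ε-isoˡ)

  F-Simulator : ∀ {P} {s : (P A.⊗₀ A.C) A.⇒ (A.T A.⊗₀ A.C)} →
                A.SimulatorData s → Simulator (F⊗ s)
  F-Simulator {s = s} d = record
    { sT = F₁ sT
    ; sC = F₁ sC ∘ φ⇒
    ; sT-functional = F-Functional sT-functional
    ; s-decomp = decomp
    ; s-delC = delC
    ; s-delT = delT
    }
    where
    open A.SimulatorData d

    decomp : F⊗ s ≡ (F₁ sT ⊗₁ (F₁ sC ∘ φ⇒)) ∘ duplicateˡ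
    decomp = begin
      F⊗ s
        ≡⟨ cong F⊗ s-decomp ⟩
      F⊗ ((sT A.⊗₁ sC) A.∘ A.duplicateˡ)
        ≡⟨ F⊗-∘ ⟩
      F⊗ (sT A.⊗₁ sC) ∘ F⊗ A.duplicateˡ
        ≡⟨ cong₂ _∘_ F⊗-⊗ F⊗-duplicateˡ ⟩
      (F₁ sT ⊗₁ F₁ sC) ∘ (id ⊗₁ φ⇒) ∘ duplicateˡ
        ≡⟨ pullˡ (trans ⊗-∘-⊗ (cong (_⊗₁ (F₁ sC ∘ φ⇒)) identityʳ)) ⟩
      (F₁ sT ⊗₁ (F₁ sC ∘ φ⇒)) ∘ duplicateˡ ∎

    delC : (id ⊗₁ del) ∘ F⊗ s ≡ F₁ sT ⊗₁ del
    delC = begin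
      (id ⊗₁ del) ∘ F⊗ s
        ≡⟨ cong (_∘ F⊗ s) id⊗del-via-F⊗ ⟩
      ((id ⊗₁ ε⇐) ∘ F⊗ (A.id A.⊗₁ A.del)) ∘ F⊗ s
        ≡⟨ trans assoc (cong ((id ⊗₁ ε⇐) ∘_) (sym F⊗-∘)) ⟩
      (id ⊗₁ ε⇐) ∘ F⊗ ((A.id A.⊗₁ A.del) A.∘ s)
        ≡⟨ cong (λ u → (id ⊗₁ ε⇐) ∘ F⊗ u) s-delC ⟩
      (id ⊗₁ ε⇐) ∘ F⊗ (sT A.⊗₁ A.del)
        ≡⟨ cong ((id ⊗₁ ε⇐) ∘_) F⊗-⊗ ⟩
      (id ⊗₁ ε⇐) ∘ (F₁ sT ⊗₁ F₁ A.del)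
        ≡⟨ trans ⊗-∘-⊗ (cong₂ _⊗₁_ identityˡ ε⇐-F-del) ⟩
      F₁ sT ⊗₁ del ∎
      where
      id⊗del-via-F⊗ : id ⊗₁ del ≡ (id ⊗₁ ε⇐) ∘ F⊗ (A.id A.⊗₁ A.del)
      id⊗del-via-F⊗ = sym (trans (cong ((id ⊗₁ ε⇐) ∘_) F⊗-⊗)
                           (trans ⊗-∘-⊗ (cong₂ _⊗₁_ (trans identityˡ F-id) ε⇐-F-del)))

    delT : λ⇒ ∘ del ⊗₁ id ∘ F⊗ s ≡ F₁ sC ∘ φ⇒
    delT = begin
      λ⇒ ∘ del ⊗₁ id ∘ F⊗ s
        ≡⟨ trans (sym assoc) (cong (_∘ F⊗ s) (sym F-π₂)) ⟩
      (F₁ A.π₂ ∘ φ⇒) ∘ φ⇐ ∘ F₁ s ∘ φ⇒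
        ≡⟨ trans assoc (cong (F₁ A.π₂ ∘_) (cancelˡ φ-isoʳ)) ⟩
      F₁ A.π₂ ∘ F₁ s ∘ φ⇒
        ≡⟨ pullˡ (sym F-∘) ⟩
      F₁ (A.π₂ A.∘ s) ∘ φ⇒
        ≡⟨ cong (λ u → F₁ u ∘ φ⇒) (trans A.assoc s-delT) ⟩
      F₁ sC ∘ φ⇒ ∎

  F↓-∘-φ⇒ : ∀ {X Y Z} {f : (X A.⊗₀ Y) A.⇒ (A.T A.⊗₀ A.C)} {k : Z ⇒ (F₀ X ⊗₀ F₀ Y)} →
            F↓ f ∘ φ⇒ ∘ k ≡ (≡⇒ F-T ⊗₁ ≡⇒ F-C) ∘ F⊗ f ∘ k
  F↓-∘-φ⇒ {f = f} {k} = begin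
    ((≡⇒ F-T ⊗₁ ≡⇒ F-C) ∘ φ⇐ ∘ F₁ f) ∘ φ⇒ ∘ k
      ≡⟨ trans assoc (cong ((≡⇒ F-T ⊗₁ ≡⇒ F-C) ∘_) assoc) ⟩
    (≡⇒ F-T ⊗₁ ≡⇒ F-C) ∘ φ⇐ ∘ F₁ f ∘ φ⇒ ∘ k
      ≡⟨ cong ((≡⇒ F-T ⊗₁ ≡⇒ F-C) ∘_) (sym (trans assoc (cong (φ⇐ ∘_) assoc))) ⟩
    (≡⇒ F-T ⊗₁ ≡⇒ F-C) ∘ F⊗ f ∘ k ∎

  F-sim-SimulatorData : ∀ {P} {s : (P A.⊗₀ A.C) A.⇒ (A.T A.⊗₀ A.C)} →
                        A.SimulatorData s → SimulatorData (F-sim s)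
  F-sim-SimulatorData d = relabel-SimulatorData F-T F-C F↓-∘-φ⇒ (F-Simulator d)

  F-sim-universal : ∀ {P} (s : (P A.⊗₀ A.C) A.⇒ (A.T A.⊗₀ A.C)) →
                    A.IsUniversalSimulator s → IsUniversalSimulator (F-sim s)
  F-sim-universal {P} s (d , r , r-functional , s∘r≽id) =
    F-sim-SimulatorData d , r′ ,
    Functional-∘ (F-Functional r-functional) (≡⇒-Functional (sym F-T)) ,
    subst₂ _≽_ F-sim∘r′ F↓-id (≽-∘ (F-≽ s∘r≽id))
    where
    r′ : T ⇒ F₀ P
    r′ = F₁ r ∘ ≡⇒ (sym F-T)

    F-TC⇐ : (T ⊗₀ C) ⇒ F₀ (A.T A.⊗₀ A.C)
    F-TC⇐ = φ⇒ ∘ ≡⇒ (sym F-T) ⊗₁ ≡⇒ (sym F-C)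

    F↓-id : F↓ A.id ∘ F-TC⇐ ≡ id
    F↓-id = trans F↓-∘-φ⇒ (trans (cong (relabel F-T F-T F-C) F⊗-id) (relabel-id F-T F-C))

    F-sim∘r′ : F↓ (s A.∘ r A.⊗₁ A.id) ∘ F-TC⇐ ≡ F-sim s ∘ r′ ⊗₁ id
    F-sim∘r′ = begin
      F↓ (s A.∘ r A.⊗₁ A.id) ∘ F-TC⇐
        ≡⟨ F↓-∘-φ⇒ ⟩
      relabel F-T F-T F-C (F⊗ (s A.∘ r A.⊗₁ A.id))
        ≡⟨ cong (relabel F-T F-T F-C) F⊗-∘-⊗id ⟩
      relabel F-T F-T F-C (F⊗ s ∘ F₁ r ⊗₁ id)
        ≡⟨ relabel-∘-⊗id F-T F-T F-C (F⊗ s) (F₁ r) ⟩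
      relabel refl F-T F-C (F⊗ s) ∘ r′ ⊗₁ id
        ≡⟨ cong (_∘ r′ ⊗₁ id) (sym F↓-∘-φ⇒) ⟩
      F-sim s ∘ r′ ⊗₁ id ∎

  F-sim-singleton : ∀ {P} (s : (P A.⊗₀ A.C) A.⇒ (A.T A.⊗₀ A.C)) →
                    A.IsSingletonSimulator s → IsSingletonSimulator (F-sim s)
  F-sim-singleton s (d , t , t-functional , sT≡t∘del) =
    F-sim-SimulatorData d , t′ ,
    Functional-∘ (≡⇒-Functional F-T)
                 (Functional-∘ (F-Functional t-functional) ε⇒-Functional) ,
    (begin
      SimulatorData.sT (F-sim-SimulatorData d)
        ≡⟨ relabel-sT F-T F-C F↓-∘-φ⇒ (F-Simulator d) ⟩
      ≡⇒ F-T ∘ F₁ (A.SimulatorData.sT d)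
        ≡⟨ cong (λ u → ≡⇒ F-T ∘ F₁ u) sT≡t∘del ⟩
      ≡⇒ F-T ∘ F₁ (t A.∘ A.del)
        ≡⟨ cong (≡⇒ F-T ∘_) (trans F-∘ (cong (F₁ t ∘_) F-del)) ⟩
      ≡⇒ F-T ∘ F₁ t ∘ ε⇒ ∘ del
        ≡⟨ trans (cong (≡⇒ F-T ∘_) (sym assoc)) (sym assoc) ⟩
      t′ ∘ del ∎)
    where
    t′ : I ⇒ T
    t′ = ≡⇒ F-T ∘ F₁ t ∘ ε⇒

mainTheorem10 : ∀ {o ℓ e o' ℓ' e'}
    {𝒜 : TargetContextCategory o ℓ e} {ℬ : TargetContextCategory o' ℓ' e'}
    (F : TargetContextFunctor 𝒜 ℬ)
    {P : TargetContextCategory.Obj 𝒜}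
    (s : TargetContextCategory._⇒_ 𝒜
           (TargetContextCategory._⊗₀_ 𝒜 P (TargetContextCategory.C 𝒜))
           (TargetContextCategory._⊗₀_ 𝒜 (TargetContextCategory.T 𝒜) (TargetContextCategory.C 𝒜))) →
    (TargetContextCategory.IsUniversalSimulator 𝒜 s →
       TargetContextCategory.IsUniversalSimulator ℬ (TargetContextFunctor.F-sim F s))
    × (TargetContextCategory.IsSingletonSimulator 𝒜 s →
       TargetContextCategory.IsSingletonSimulator ℬ (TargetContextFunctor.F-sim F s))
mainTheorem10 F s = F-sim-universal s , F-sim-singleton s
  where open TargetContextFunctorProperties F
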